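{- Let $G$ be a connected graph. The following are equivalent: (i) $Z_c(G)=1$; (ii) $pt_c(G)=|G|-1$; (iii) $PT_c(G)=|G|-1$; (iv) $G$ is a path.
   Context: All graphs are finite and simple. Color-change rule: if a black vertex $u$ has exactly one white neighbor $v$, then $v$ becomes black. A zero forcing set of $G$ is a set $Z\subseteq V(G)$ such that, starting with exactly $Z$ black, repeated application of the rule makes all vertices black. A connected zero forcing set is a zero forcing set $S$ such that for every connected component $C$ of $G$, $S\cap V(C)$ induces a connected subgraph; $Z_c(G)$ is the minimum size of one, and such a set of size $Z_c(G)$ is a minimum connected zero forcing set. For a connected zero forcing set $B$, put $B^{(0)}=B$ and for $t\ge0$ let $B^{(t+1)}$ be the set of vertices $w$ such that some vertex $b\in\bigcup_{s=0}^t B^{(s)}$ has $w$ as its only neighbor not in $\bigcup_{s=0}^t B^{(s)}$. The connected propagation time $pt_c(G,B)$ is the least $t'$ with $V(G)=\bigcup_{s=0}^{t'}B^{(s)}$. Then $pt_c(G)=\min\{pt_c(G,B)\}$ and $PT_c(G)=\max\{pt_c(G,B)\}$, over all minimum connected zero forcing sets $B$ of $G$. -}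

module Defs where

open import Data.Nat using (ℕ; zero; suc; _+_; _≤_; _<_; _≡ᵇ_)
open import Data.Fin using (Fin; toℕ; _≟_)
import Data.Fin as F
open import Data.Bool using (Bool; true; false; _∧_; _∨_; not; if_then_else_)
open import Data.Product using (Σ; _×_; ∃; _,_)
open import Relation.Nullary using (¬_)
open import Relation.Nullary.Decidable using (⌊_⌋)
open import Relation.Binary.PropositionalEquality using (_≡_; _≢_)
open import Relation.Binary.Construct.Closure.ReflexiveTransitive using (Star)
open import Function.Bundles using (_↔_; Inverse)

record Graph (n : ℕ) : Set where
  field
    adj    : Fin n → Fin n → Bool
    sym    : ∀ u v → adj u v ≡ adj v u
    irrefl : ∀ u → adj u u ≡ false
open Graph public

VSet : ℕ → Set
VSet n = Fin n → Bool

anyF : ∀ {n} → (Fin n → Bool) → Bool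
anyF {zero}  f = false
anyF {suc n} f = f F.zero ∨ anyF (λ i → f (F.suc i))

allF : ∀ {n} → (Fin n → Bool) → Bool
allF {zero}  f = true
allF {suc n} f = f F.zero ∧ allF (λ i → f (F.suc i))

size : ∀ {n} → VSet n → ℕ
size {zero}  S = 0
size {suc n} S = (if S F.zero then 1 else 0) + size (λ i → S (F.suc i))

Full : ∀ {n} → VSet n → Set
Full S = ∀ x → S x ≡ true

data WalkIn {n} (G : Graph n) (P : VSet n) : Fin n → Fin n → Set where
  here : ∀ {u} → P u ≡ true → WalkIn G P u u
  step : ∀ {u v w} → P u ≡ true → adj G u v ≡ true → WalkIn G P v w → WalkIn G P u w

Connected : ∀ {n} → Graph n → Set
Connected G = ∀ u v → WalkIn G (λ _ → true) u v

ForceStep : ∀ {n} → Graph n → VSet n → VSet n → Set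
ForceStep {n} G S S' = Σ (Fin n) λ u → Σ (Fin n) λ v →
  S u ≡ true × S v ≡ false × adj G u v ≡ true ×
  (∀ x → adj G u x ≡ true → x ≢ v → S x ≡ true) ×
  (∀ x → S' x ≡ (S x ∨ ⌊ x ≟ v ⌋))

ZeroForcingSet : ∀ {n} → Graph n → VSet n → Set
ZeroForcingSet {n} G Z = Σ (VSet n) λ S → Star (ForceStep G) Z S × Full S

-- For every component C of G, S ∩ V(C) induces a connected subgraph:
-- any two vertices of S joined by a walk in G are joined by a walk inside S.
InducesConnectedOnComponents : ∀ {n} → Graph n → VSet n → Set
InducesConnectedOnComponents G S =
  ∀ u v → S u ≡ true → S v ≡ true → WalkIn G (λ _ → true) u v → WalkIn G S u v

ConnectedZFS : ∀ {n} → Graph n → VSet n → Set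
ConnectedZFS G S = ZeroForcingSet G S × InducesConnectedOnComponents G S

MinConnectedZFS : ∀ {n} → Graph n → VSet n → Set
MinConnectedZFS {n} G S = ConnectedZFS G S × (∀ (T : VSet n) → ConnectedZFS G T → size S ≤ size T)

IsZc : ∀ {n} → Graph n → ℕ → Set
IsZc {n} G k = (Σ (VSet n) λ S → ConnectedZFS G S × size S ≡ k)
             × (∀ (S : VSet n) → ConnectedZFS G S → k ≤ size S)

forces : ∀ {n} → Graph n → VSet n → Fin n → Fin n → Bool
forces G S b w = S b ∧ not (S w) ∧ adj G b w ∧
  allF (λ x → not (adj G b x) ∨ S x ∨ ⌊ x ≟ w ⌋)

cum : ∀ {n} → Graph n → VSet n → ℕ → VSet n
cum G B zero    x = B x
cum G B (suc t) x = cum G B t x ∨ anyF (λ b → forces G (cum G B t) b x)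

IsPtcOf : ∀ {n} → Graph n → VSet n → ℕ → Set
IsPtcOf G B t = Full (cum G B t) × (∀ t' → t' < t → ¬ Full (cum G B t'))

IsPtc : ∀ {n} → Graph n → ℕ → Set
IsPtc {n} G p = (Σ (VSet n) λ B → MinConnectedZFS G B × IsPtcOf G B p)
              × (∀ (B : VSet n) (t : ℕ) → MinConnectedZFS G B → IsPtcOf G B t → p ≤ t)

IsPTc : ∀ {n} → Graph n → ℕ → Set
IsPTc {n} G p = (Σ (VSet n) λ B → MinConnectedZFS G B × IsPtcOf G B p)
              × (∀ (B : VSet n) (t : ℕ) → MinConnectedZFS G B → IsPtcOf G B t → t ≤ p)

pathAdj : ∀ {n} → Fin n → Fin n → Bool
pathAdj i j = (suc (toℕ i) ≡ᵇ toℕ j) ∨ (suc (toℕ j) ≡ᵇ toℕ i)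

IsPath : ∀ {n} → Graph n → Set
IsPath {n} G = Σ (Fin n ↔ Fin n) λ f →
  ∀ u v → adj G u v ≡ pathAdj (Inverse.to f u) (Inverse.to f v)

module Submission where

-- The heart of the proof is the notion of a *chain*: a black set S whose
-- vertices can be numbered 0,…,k so that G restricted to S is the path
-- 0 - 1 - … - k, and every black vertex other than the tip k has only black
-- neighbours.  A single vertex is a chain.  In a chain only the tip can force
-- and it has at most one white neighbour, so a force turns a chain into a
-- chain one vertex longer, and a synchronous round adds at most one vertex.
-- Hence a one-vertex zero forcing set exhibits G as a path, and from one
-- vertex the propagation time is at least n.  Independently, every round of
-- a propagation adds a vertex, so |B| + pt_c(G,B) ≤ n + 1; thus propagation
-- time n forces |B| = 1.  Conversely, on a path an endpoint forces the
-- vertices in order: it is a minimum connected zero forcing set with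
-- propagation time exactly n.

open import Defs hiding (sym; step)
open import Data.Nat using (ℕ; zero; suc; _+_; _∸_; _≤_; _<_; _≡ᵇ_; z≤n; s≤s; _≤?_)
open import Data.Nat.Properties
  using (≤-refl; ≤-trans; ≤-reflexive; ≤-antisym; ≤-pred; n≤1+n; n≮n; suc-injective;
         m≤n⇒m<n∨m≡n; m∸n+n≡m; ≡ᵇ⇒≡; ≡⇒≡ᵇ; +-suc; +-identityʳ; +-cancelʳ-≤; +-monoˡ-≤; n≤0⇒n≡0; module ≤-Reasoning)
open import Data.Fin using (Fin; toℕ; _≟_; fromℕ<)
import Data.Fin as F
open import Data.Fin.Properties using (toℕ-injective; toℕ-fromℕ<; toℕ<n; all?; ¬∀⟶∃¬)
open import Data.Bool using (Bool; true; false; _∧_; _∨_; not; if_then_else_)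
import Data.Bool as Bool
open import Data.Bool.Properties using (∨-comm; ∨-zeroʳ; ∨-identityʳ; T-≡)
open import Data.Product using (Σ; _×_; _,_; proj₁; proj₂)
open import Data.Sum using (_⊎_; inj₁; inj₂; [_,_])
open import Data.Empty using (⊥; ⊥-elim)
open import Relation.Nullary using (¬_; Dec; yes; no)
open import Relation.Nullary.Decidable using (⌊_⌋; ⌊⌋-map′)
open import Relation.Binary.PropositionalEquality hiding ([_])
open import Relation.Binary.Construct.Closure.ReflexiveTransitive using (Star; ε; _◅_; _◅◅_)
open import Function using (_∘_)
open import Function.Bundles using (Inverse; mk↔ₛ′; _⇔_; mk⇔; Equivalence)

true≢false : ∀ {a} → a ≡ true → a ≡ false → ⊥
true≢false refl ()

true-or-false : ∀ a → a ≡ true ⊎ a ≡ false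
true-or-false true  = inj₁ refl
true-or-false false = inj₂ refl

not-true : ∀ {a} → ¬ (a ≡ true) → a ≡ false
not-true {true}  ¬t = ⊥-elim (¬t refl)
not-true {false} _  = refl

∨-introˡ : ∀ {a} b → a ≡ true → a ∨ b ≡ true
∨-introˡ b p = cong (_∨ b) p

∨-introʳ : ∀ a {b} → b ≡ true → a ∨ b ≡ true
∨-introʳ a p = trans (cong (a ∨_) p) (∨-zeroʳ a)

∨-elim : ∀ a {b} → a ∨ b ≡ true → a ≡ true ⊎ b ≡ true
∨-elim true  _ = inj₁ refl
∨-elim false p = inj₂ p

∧-elim : ∀ {a b} → a ∧ b ≡ true → a ≡ true × b ≡ true
∧-elim {true} p = refl , p

∨-right : ∀ {a b} → a ≡ false → a ∨ b ≡ true → b ≡ true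
∨-right refl p = p

⌊⌋-true : ∀ {A : Set} (d : Dec A) → A → ⌊ d ⌋ ≡ true
⌊⌋-true (yes _) _ = refl
⌊⌋-true (no ¬a) a = ⊥-elim (¬a a)

⌊⌋-false : ∀ {A : Set} (d : Dec A) → ¬ A → ⌊ d ⌋ ≡ false
⌊⌋-false (yes a) ¬a = ⊥-elim (¬a a)
⌊⌋-false (no _)  _  = refl

⌊⌋-witness : ∀ {A : Set} (d : Dec A) → ⌊ d ⌋ ≡ true → A
⌊⌋-witness (yes a) _ = a

anyF-intro : ∀ {m} (f : Fin m → Bool) i → f i ≡ true → anyF f ≡ true
anyF-intro f F.zero    p = ∨-introˡ _ p
anyF-intro f (F.suc i) p = ∨-introʳ (f F.zero) (anyF-intro (λ j → f (F.suc j)) i p)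

anyF-elim : ∀ {m} (f : Fin m → Bool) → anyF f ≡ true → Σ (Fin m) λ i → f i ≡ true
anyF-elim {suc m} f p with ∨-elim (f F.zero) p
... | inj₁ p₀ = F.zero , p₀
... | inj₂ ps with anyF-elim (λ j → f (F.suc j)) ps
...   | i , pᵢ = F.suc i , pᵢ

anyF-false : ∀ {m} (f : Fin m → Bool) → (∀ i → ¬ (f i ≡ true)) → anyF f ≡ false
anyF-false f none = not-true (λ p → let (i , pᵢ) = anyF-elim f p in none i pᵢ)

allF-elim : ∀ {m} (f : Fin m → Bool) → allF f ≡ true → ∀ i → f i ≡ true
allF-elim f p F.zero    = proj₁ (∧-elim p)
allF-elim f p (F.suc i) = allF-elim (λ j → f (F.suc j)) (proj₂ (∧-elim p)) i

allF-intro : ∀ {m} (f : Fin m → Bool) → (∀ i → f i ≡ true) → allF f ≡ true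
allF-intro {zero}  f h = refl
allF-intro {suc m} f h = cong₂ _∧_ (h F.zero) (allF-intro (λ j → f (F.suc j)) (λ j → h (F.suc j)))

anyF-cong : ∀ {m} (f g : Fin m → Bool) → (∀ i → f i ≡ g i) → anyF f ≡ anyF g
anyF-cong {zero}  f g h = refl
anyF-cong {suc m} f g h = cong₂ _∨_ (h F.zero) (anyF-cong _ _ (λ j → h (F.suc j)))

allF-cong : ∀ {m} (f g : Fin m → Bool) → (∀ i → f i ≡ g i) → allF f ≡ allF g
allF-cong {zero}  f g h = refl
allF-cong {suc m} f g h = cong₂ _∧_ (h F.zero) (allF-cong _ _ (λ j → h (F.suc j)))

_⊆_ : ∀ {m} → VSet m → VSet m → Set
S ⊆ S' = ∀ x → S x ≡ true → S' x ≡ true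

tail : ∀ {m} → VSet (suc m) → VSet m
tail S i = S (F.suc i)

size-cong : ∀ {m} (S S' : VSet m) → (∀ x → S x ≡ S' x) → size S ≡ size S'
size-cong {zero}  S S' h = refl
size-cong {suc m} S S' h =
  cong₂ (λ a k → (if a then 1 else 0) + k) (h F.zero) (size-cong (tail S) (tail S') (λ j → h (F.suc j)))

size-≤ : ∀ {m} (S : VSet m) → size S ≤ m
size-≤ {zero}  S = z≤n
size-≤ {suc m} S with S F.zero
... | true  = s≤s (size-≤ (tail S))
... | false = ≤-trans (size-≤ (tail S)) (n≤1+n m)

size-full : ∀ {m} (S : VSet m) → Full S → size S ≡ m
size-full {zero}  S h = refl
size-full {suc m} S h rewrite h F.zero = cong suc (size-full (tail S) (λ j → h (F.suc j)))

size-empty : ∀ m → size {m} (λ _ → false) ≡ 0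
size-empty zero    = refl
size-empty (suc m) = size-empty m

size-zero : ∀ {m} (S : VSet m) → size S ≡ 0 → ∀ x → S x ≡ false
size-zero {suc m} S p x with S F.zero in S₀
size-zero {suc m} S () x         | true
size-zero {suc m} S p F.zero     | false = S₀
size-zero {suc m} S p (F.suc x)  | false = size-zero (tail S) p x

size-one : ∀ {m} (S : VSet m) → size S ≡ 1 →
  Σ (Fin m) λ x → S x ≡ true × (∀ y → S y ≡ true → y ≡ x)
size-one {suc m} S p with S F.zero in S₀
... | true = F.zero , S₀ , λ
  { F.zero    _  → refl
  ; (F.suc y) Sy → ⊥-elim (true≢false Sy (size-zero (tail S) (suc-injective p) y)) }
... | false with size-one (tail S) p
...   | x , Sx , unique = F.suc x , Sx , λ
  { F.zero    Sy → ⊥-elim (true≢false Sy S₀)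
  ; (F.suc y) Sy → cong F.suc (unique y Sy) }

size-insert : ∀ {m} (S S' : VSet m) v → S v ≡ false →
  (∀ x → S' x ≡ (S x ∨ ⌊ x ≟ v ⌋)) → size S' ≡ suc (size S)
size-insert {suc m} S S' F.zero Sv S'≡ rewrite S'≡ F.zero | Sv =
  cong suc (size-cong (tail S') (tail S) λ j → trans (S'≡ (F.suc j)) (∨-identityʳ (S (F.suc j))))
size-insert {suc m} S S' (F.suc v) Sv S'≡ =
  trans (cong₂ (λ a k → (if a then 1 else 0) + k) (S'≡ F.zero) (size-insert (tail S) (tail S') v Sv shift))
        (count-suc (S F.zero))
  where
  shift : ∀ j → tail S' j ≡ (tail S j ∨ ⌊ j ≟ v ⌋)
  shift j = trans (S'≡ (F.suc j)) (cong (S (F.suc j) ∨_) (⌊⌋-map′ _ _ (j ≟ v)))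
  count-suc : ∀ a {k} → (if a ∨ false then 1 else 0) + suc k ≡ suc ((if a then 1 else 0) + k)
  count-suc true  = refl
  count-suc false = refl

size-singleton : ∀ {m} (S : VSet m) v → (∀ x → S x ≡ ⌊ x ≟ v ⌋) → size S ≡ 1
size-singleton {m} S v S≡ = trans (size-insert (λ _ → false) S v refl S≡) (cong suc (size-empty m))

size-mono : ∀ {m} (S S' : VSet m) → S ⊆ S' → size S ≤ size S'
size-mono {zero}  S S' h = z≤n
size-mono {suc m} S S' h with S F.zero in S₀ | S' F.zero in S'₀
... | true  | true  = s≤s (size-mono (tail S) (tail S') (λ j → h (F.suc j)))
... | true  | false = ⊥-elim (true≢false (h F.zero S₀) S'₀)
... | false | true  = ≤-trans (size-mono (tail S) (tail S') (λ j → h (F.suc j))) (n≤1+n _)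
... | false | false = size-mono (tail S) (tail S') (λ j → h (F.suc j))

⊆-new : ∀ {m} (S S' : VSet m) → S ⊆ S' → ∀ x → S x ≢ S' x → S x ≡ false × S' x ≡ true
⊆-new S S' h x S≢S' with true-or-false (S x) | true-or-false (S' x)
... | inj₁ Sx | _        = ⊥-elim (S≢S' (trans Sx (sym (h x Sx))))
... | inj₂ Sx | inj₁ S'x = Sx , S'x
... | inj₂ Sx | inj₂ S'x = ⊥-elim (S≢S' (trans Sx (sym S'x)))

size-strict : ∀ {m} (S S' : VSet m) → S ⊆ S' → ∀ x → S' x ≡ true → S x ≡ false →
  suc (size S) ≤ size S'
size-strict {suc m} S S' h F.zero S'x Sx rewrite S'x | Sx =
  s≤s (size-mono (tail S) (tail S') (λ j → h (F.suc j)))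
size-strict {suc m} S S' h (F.suc x) S'x Sx with S F.zero in S₀ | S' F.zero in S'₀
... | true  | true  = s≤s (size-strict (tail S) (tail S') (λ j → h (F.suc j)) x S'x Sx)
... | true  | false = ⊥-elim (true≢false (h F.zero S₀) S'₀)
... | false | true  = ≤-trans (size-strict (tail S) (tail S') (λ j → h (F.suc j)) x S'x Sx) (n≤1+n _)
... | false | false = size-strict (tail S) (tail S') (λ j → h (F.suc j)) x S'x Sx

module _ {m} (G : Graph m) where

  Forces : VSet m → Fin m → Fin m → Set
  Forces S b x = S b ≡ true × S x ≡ false × adj G b x ≡ true ×
                 (∀ y → adj G b y ≡ true → y ≢ x → S y ≡ true)

  forces-sound : ∀ S b x → forces G S b x ≡ true → Forces S b x
  forces-sound S b x p =
    let (Sb , p₁)        = ∧-elim p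
        (notSx , p₂)     = ∧-elim p₁
        (abx , rule-all) = ∧-elim p₂
    in Sb , not-true (λ Sx → true≢false notSx (cong not Sx)) , abx ,
       λ y aby y≢x → only y aby y≢x (allF-elim rule rule-all y)
    where
    rule : Fin m → Bool
    rule y = not (adj G b y) ∨ S y ∨ ⌊ y ≟ x ⌋
    only : ∀ y → adj G b y ≡ true → y ≢ x → rule y ≡ true → S y ≡ true
    only y aby y≢x r rewrite aby | ⌊⌋-false (y ≟ x) y≢x with S y
    ... | true = refl

  forces-complete : ∀ S b x → Forces S b x → forces G S b x ≡ true
  forces-complete S b x (Sb , Sx , abx , others) rewrite Sb | Sx | abx =
    allF-intro _ rule
    where
    rule : ∀ y → (not (adj G b y) ∨ S y ∨ ⌊ y ≟ x ⌋) ≡ true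
    rule y with adj G b y in aby | y ≟ x
    ... | false | _     = refl
    ... | true  | yes _ = ∨-introʳ (S y) refl
    ... | true  | no y≢x = ∨-introˡ _ (others y aby y≢x)

  -- One synchronous round: every vertex forced by some black vertex turns
  -- black.  By definition  cum G B (suc t) = round (cum G B t).
  round : VSet m → VSet m
  round S x = S x ∨ anyF (λ b → forces G S b x)

  round-⊇ : ∀ S → S ⊆ round S
  round-⊇ S x Sx = ∨-introˡ _ Sx

  round-cong : ∀ S S' → (∀ x → S x ≡ S' x) → ∀ x → round S x ≡ round S' x
  round-cong S S' h x = cong₂ _∨_ (h x) (anyF-cong _ _ λ b → forces-cong b)
    where
    forces-cong : ∀ b → forces G S b x ≡ forces G S' b x
    forces-cong b = cong₂ _∧_ (h b) (cong₂ _∧_ (cong not (h x)) (cong (adj G b x ∧_)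
      (allF-cong _ _ λ y → cong (λ z → not (adj G b y) ∨ z ∨ ⌊ y ≟ x ⌋) (h y))))

  cum-stuck : ∀ B t → (∀ x → cum G B t x ≡ round (cum G B t) x) →
    ∀ j x → cum G B (j + t) x ≡ cum G B t x
  cum-stuck B t stuck zero    x = refl
  cum-stuck B t stuck (suc j) x =
    trans (round-cong (cum G B (j + t)) (cum G B t) (cum-stuck B t stuck j) x) (sym (stuck x))

  round-new : ∀ S → ¬ (∀ x → S x ≡ round S x) →
    Σ (Fin m) λ x → S x ≡ false × round S x ≡ true
  round-new S moves =
    let (x , S≢round) = ¬∀⟶∃¬ m _ (λ x → Bool._≟_ (S x) (round S x)) moves in
    x , ⊆-new S (round S) (round-⊇ S) x S≢round

  round-grows : ∀ B t → IsPtcOf G B t → ∀ t' → t' < t →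
    suc (size (cum G B t')) ≤ size (cum G B (suc t'))
  round-grows B t (full , notYet) t' t'<t =
    let (x , Sx , roundSx) = round-new S not-stuck in
    size-strict S (round S) (round-⊇ S) x roundSx Sx
    where
    S : VSet m
    S = cum G B t'
    not-stuck : ¬ (∀ x → S x ≡ round S x)
    not-stuck stuck = notYet t' t'<t λ x → begin
      S x                           ≡⟨ cum-stuck B t' stuck (t ∸ t') x ⟨
      cum G B (t ∸ t' + t') x       ≡⟨ cong (λ s → cum G B s x) (m∸n+n≡m (≤-trans (n≤1+n t') t'<t)) ⟩
      cum G B t x                   ≡⟨ full x ⟩
      true                          ∎
      where open ≡-Reasoning

  ptc-bound : ∀ B t → IsPtcOf G B t → size B + t ≤ m
  ptc-bound B t ptc = ≤-trans (grown t ≤-refl) (size-≤ (cum G B t))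
    where
    grown : ∀ t' → t' ≤ t → size B + t' ≤ size (cum G B t')
    grown zero     _    = ≤-reflexive (+-identityʳ (size B))
    grown (suc t') t'<t = ≤-trans (≤-reflexive (+-suc (size B) t'))
      (≤-trans (s≤s (grown t' (≤-trans (n≤1+n t') t'<t))) (round-grows B t ptc t' t'<t))

-- On a nonempty vertex set a zero forcing set is nonempty: a force needs a
-- black vertex, and without forces the initial set is already everything.
zfs-nonempty : ∀ {n} (G : Graph (suc n)) Z → ZeroForcingSet G Z → 1 ≤ size Z
zfs-nonempty G Z zfs with size Z in |Z|
... | suc _ = s≤s z≤n
zfs-nonempty G Z (S , ε , full)                    | zero =
  ⊥-elim (true≢false (full F.zero) (size-zero Z |Z| F.zero))
zfs-nonempty G Z (S , (u , _ , Zu , _) ◅ _ , full) | zero =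
  ⊥-elim (true≢false Zu (size-zero Z |Z| u))

-- Adjacency of the path graph in terms of positions: pathAdj i j is
-- definitionally  consecutive (toℕ i) (toℕ j).
consecutive : ℕ → ℕ → Bool
consecutive a b = (suc a ≡ᵇ b) ∨ (suc b ≡ᵇ a)

≡ᵇ-true : ∀ a b → (a ≡ᵇ b) ≡ true → a ≡ b
≡ᵇ-true a b p = ≡ᵇ⇒≡ a b (Equivalence.from T-≡ p)

≡ᵇ-refl : ∀ a → (a ≡ᵇ a) ≡ true
≡ᵇ-refl a = Equivalence.to T-≡ (≡⇒≡ᵇ a a refl)

consecutive-sym : ∀ a b → consecutive a b ≡ consecutive b a
consecutive-sym a b = ∨-comm (suc a ≡ᵇ b) (suc b ≡ᵇ a)

consecutive-suc : ∀ a → consecutive a (suc a) ≡ true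
consecutive-suc a = ∨-introˡ _ (≡ᵇ-refl a)

consecutive-elim : ∀ a b → consecutive a b ≡ true → suc a ≡ b ⊎ suc b ≡ a
consecutive-elim a b p with ∨-elim (suc a ≡ᵇ b) p
... | inj₁ q = inj₁ (≡ᵇ-true _ _ q)
... | inj₂ q = inj₂ (≡ᵇ-true _ _ q)

consecutive-far : ∀ a b → suc a ≢ b → suc b ≢ a → consecutive a b ≡ false
consecutive-far a b a+1≢b b+1≢a =
  cong₂ _∨_ (not-true (a+1≢b ∘ ≡ᵇ-true _ _)) (not-true (b+1≢a ∘ ≡ᵇ-true _ _))

consecutive-irrefl : ∀ a → consecutive a a ≡ false
consecutive-irrefl a = consecutive-far a a (λ e → n≮n a (≤-reflexive e)) (λ e → n≮n a (≤-reflexive e))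

record Chain {m} (G : Graph m) (S : VSet m) : Set where
  field
    k         : ℕ
    lab       : Fin m → ℕ
    tip       : Fin m
    tip-black : S tip ≡ true
    lab-tip   : lab tip ≡ k
    lab-≤     : ∀ u → S u ≡ true → lab u ≤ k
    lab-inj   : ∀ u v → S u ≡ true → S v ≡ true → lab u ≡ lab v → u ≡ v
    lab-onto  : ∀ i → i ≤ k → Σ (Fin m) λ u → S u ≡ true × lab u ≡ i
    closed    : ∀ u → S u ≡ true → u ≢ tip → ∀ w → adj G u w ≡ true → S w ≡ true
    adj-lab   : ∀ u w → S u ≡ true → S w ≡ true → adj G u w ≡ consecutive (lab u) (lab w)
    size-S    : size S ≡ suc k

module _ {m} (G : Graph m) where

  chain-singleton : ∀ S → size S ≡ 1 → Chain G S
  chain-singleton S |S|≡1 = chain-at (size-one S |S|≡1)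
    where
    chain-at : Σ (Fin m) (λ x → S x ≡ true × (∀ y → S y ≡ true → y ≡ x)) → Chain G S
    chain-at (x , Sx , only) = record
      { k         = 0
      ; lab       = λ _ → 0
      ; tip       = x
      ; tip-black = Sx
      ; lab-tip   = refl
      ; lab-≤     = λ _ _ → z≤n
      ; lab-inj   = λ u v Su Sv _ → trans (only u Su) (sym (only v Sv))
      ; lab-onto  = λ { zero _ → x , Sx , refl }
      ; closed    = λ u Su u≢x → ⊥-elim (u≢x (only u Su))
      ; adj-lab   = λ u w Su Sw → trans (cong₂ (adj G) (only u Su) (only w Sw)) (Graph.irrefl G x)
      ; size-S    = |S|≡1
      }

  chain-cong : ∀ {S S'} → (∀ x → S x ≡ S' x) → (c : Chain G S) →
    Σ (Chain G S') λ c' → Chain.k c' ≡ Chain.k c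
  chain-cong {S} {S'} S≡S' c = record
    { k         = k
    ; lab       = lab
    ; tip       = tip
    ; tip-black = to tip tip-black
    ; lab-tip   = lab-tip
    ; lab-≤     = λ u S'u → lab-≤ u (from u S'u)
    ; lab-inj   = λ u v S'u S'v → lab-inj u v (from u S'u) (from v S'v)
    ; lab-onto  = λ i i≤k → let (u , Su , lu) = lab-onto i i≤k in u , to u Su , lu
    ; closed    = λ u S'u u≢tip w auw → to w (closed u (from u S'u) u≢tip w auw)
    ; adj-lab   = λ u w S'u S'w → adj-lab u w (from u S'u) (from w S'w)
    ; size-S    = trans (sym (size-cong S S' S≡S')) size-S
    } , refl
    where
    open Chain c
    to : S ⊆ S'
    to x Sx = trans (sym (S≡S' x)) Sx
    from : S' ⊆ S
    from x S'x = trans (S≡S' x) S'x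

  -- In a chain only the tip can force: every other black vertex has no white neighbour.
  forcer-is-tip : ∀ {S b x} → (c : Chain G S) → Forces G S b x → b ≡ Chain.tip c
  forcer-is-tip {b = b} c (Sb , Sx , abx , _) with b ≟ Chain.tip c
  ... | yes b≡tip = b≡tip
  ... | no  b≢tip = ⊥-elim (true≢false (Chain.closed c _ Sb b≢tip _ abx) Sx)

  forced-unique : ∀ {S b b' x y} → Chain G S → Forces G S b x → Forces G S b' y → x ≡ y
  forced-unique {b = b} {x = x} {y} c fx@(_ , _ , _ , others) fy@(_ , Sy , b'y , _) with x ≟ y
  ... | yes x≡y = x≡y
  ... | no  x≢y = ⊥-elim (true≢false (others y by (x≢y ∘ sym)) Sy)
    where
    by : adj G b y ≡ true
    by = subst (λ z → adj G z y ≡ true) (trans (forcer-is-tip c fy) (sym (forcer-is-tip c fx))) b'y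

  -- A force on a chain appends the forced vertex as the new tip.
  chain-extend : ∀ {S S'} → (c : Chain G S) → ForceStep G S S' →
    Σ (Chain G S') λ c' → Chain.k c' ≡ suc (Chain.k c)
  chain-extend {S} {S'} c (u , v , Su , Sv , auv , others , S'≡) = c' , refl
    where
    open Chain c
    u≡tip : u ≡ tip
    u≡tip = forcer-is-tip c (Su , Sv , auv , others)

    old⊆new : S ⊆ S'
    old⊆new x Sx = trans (S'≡ x) (∨-introˡ _ Sx)
    S'v : S' v ≡ true
    S'v = trans (S'≡ v) (∨-introʳ (S v) (⌊⌋-true (v ≟ v) refl))
    new-black : ∀ x → S' x ≡ true → S x ≡ true ⊎ x ≡ v
    new-black x S'x with ∨-elim (S x) (trans (sym (S'≡ x)) S'x)
    ... | inj₁ Sx = inj₁ Sx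
    ... | inj₂ x≡v = inj₂ (⌊⌋-witness (x ≟ v) x≡v)

    lab' : Fin m → ℕ
    lab' x with x ≟ v
    ... | yes _ = suc k
    ... | no  _ = lab x
    lab'-v : lab' v ≡ suc k
    lab'-v with v ≟ v
    ... | yes _   = refl
    ... | no  v≢v = ⊥-elim (v≢v refl)
    lab'-old : ∀ x → S x ≡ true → lab' x ≡ lab x
    lab'-old x Sx with x ≟ v
    ... | yes refl = ⊥-elim (true≢false Sx Sv)
    ... | no  _    = refl

    lab≢suc-k : ∀ x → S x ≡ true → lab x ≢ suc k
    lab≢suc-k x Sx e = n≮n k (≤-trans (≤-reflexive (sym e)) (lab-≤ x Sx))

    adj-v : ∀ w → S w ≡ true → adj G w v ≡ consecutive (lab w) (suc k)
    adj-v w Sw with w ≟ tip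
    ... | yes refl = trans (subst (λ z → adj G z v ≡ true) u≡tip auv)
                           (sym (subst (λ a → consecutive a (suc k) ≡ true) (sym lab-tip) (consecutive-suc k)))
    ... | no  w≢tip = trans (not-true (λ awv → true≢false (closed w Sw w≢tip v awv) Sv))
                            (sym (consecutive-far (lab w) (suc k) not-tip-lab too-big))
      where
      not-tip-lab : suc (lab w) ≢ suc k
      not-tip-lab e = w≢tip (lab-inj w tip Sw tip-black (trans (suc-injective e) (sym lab-tip)))
      too-big : suc (suc k) ≢ lab w
      too-big e = n≮n (suc k) (≤-trans (≤-reflexive e) (≤-trans (lab-≤ w Sw) (n≤1+n k)))

    c' : Chain G S'
    c' = record
      { k         = suc k
      ; lab       = lab'
      ; tip       = v
      ; tip-black = S'v
      ; lab-tip   = lab'-v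
      ; lab-≤     = lab'-≤
      ; lab-inj   = lab'-inj
      ; lab-onto  = lab'-onto
      ; closed    = closed'
      ; adj-lab   = adj-lab'
      ; size-S    = trans (size-insert S S' v Sv S'≡) (cong suc size-S)
      }
      where
      lab'-≤ : ∀ x → S' x ≡ true → lab' x ≤ suc k
      lab'-≤ x S'x with new-black x S'x
      ... | inj₁ Sx   = ≤-trans (≤-reflexive (lab'-old x Sx)) (≤-trans (lab-≤ x Sx) (n≤1+n k))
      ... | inj₂ refl = ≤-reflexive lab'-v

      lab'-inj : ∀ x y → S' x ≡ true → S' y ≡ true → lab' x ≡ lab' y → x ≡ y
      lab'-inj x y S'x S'y e with new-black x S'x | new-black y S'y
      ... | inj₁ Sx   | inj₁ Sy   = lab-inj x y Sx Sy (trans (sym (lab'-old x Sx)) (trans e (lab'-old y Sy)))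
      ... | inj₁ Sx   | inj₂ refl = ⊥-elim (lab≢suc-k x Sx (trans (sym (lab'-old x Sx)) (trans e lab'-v)))
      ... | inj₂ refl | inj₁ Sy   = ⊥-elim (lab≢suc-k y Sy (trans (sym (lab'-old y Sy)) (trans (sym e) lab'-v)))
      ... | inj₂ refl | inj₂ refl = refl

      lab'-onto : ∀ i → i ≤ suc k → Σ (Fin m) λ x → S' x ≡ true × lab' x ≡ i
      lab'-onto i i≤k+1 with m≤n⇒m<n∨m≡n i≤k+1
      ... | inj₂ i≡k+1 = v , S'v , trans lab'-v (sym i≡k+1)
      ... | inj₁ i≤k   = let (x , Sx , lx) = lab-onto i (≤-pred i≤k) in
                         x , old⊆new x Sx , trans (lab'-old x Sx) lx

      closed' : ∀ x → S' x ≡ true → x ≢ v → ∀ w → adj G x w ≡ true → S' w ≡ true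
      closed' x S'x x≢v w axw with new-black x S'x
      ... | inj₂ x≡v = ⊥-elim (x≢v x≡v)
      ... | inj₁ Sx with x ≟ tip | w ≟ v
      ...   | no  x≢tip | _        = old⊆new w (closed x Sx x≢tip w axw)
      ...   | yes _     | yes refl = S'v
      ...   | yes x≡tip | no  w≢v  =
              old⊆new w (others w (subst (λ z → adj G z w ≡ true) (trans x≡tip (sym u≡tip)) axw) w≢v)

      adj-lab' : ∀ x w → S' x ≡ true → S' w ≡ true → adj G x w ≡ consecutive (lab' x) (lab' w)
      adj-lab' x w S'x S'w with new-black x S'x | new-black w S'w
      ... | inj₁ Sx   | inj₁ Sw   = trans (adj-lab x w Sx Sw) (sym (cong₂ consecutive (lab'-old x Sx) (lab'-old w Sw)))
      ... | inj₁ Sx   | inj₂ refl = trans (adj-v x Sx) (sym (cong₂ consecutive (lab'-old x Sx) lab'-v))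
      ... | inj₂ refl | inj₁ Sw   = begin
        adj G v w                     ≡⟨ Graph.sym G v w ⟩
        adj G w v                     ≡⟨ adj-v w Sw ⟩
        consecutive (lab w) (suc k)   ≡⟨ consecutive-sym (lab w) (suc k) ⟩
        consecutive (suc k) (lab w)   ≡⟨ cong₂ consecutive lab'-v (lab'-old w Sw) ⟨
        consecutive (lab' v) (lab' w) ∎
        where open ≡-Reasoning
      ... | inj₂ refl | inj₂ refl = trans (Graph.irrefl G v) (sym (consecutive-irrefl (lab' v)))

  chain-along : ∀ {S S'} → Star (ForceStep G) S S' → Chain G S → Chain G S'
  chain-along ε          c = c
  chain-along (fs ◅ fss) c = chain-along fss (proj₁ (chain-extend c fs))

  round-single : ∀ {S b x} → Forces G S b x → (∀ b' y → Forces G S b' y → y ≡ x) →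
    ∀ y → round G S y ≡ (S y ∨ ⌊ y ≟ x ⌋)
  round-single {S} {b} {x} fx only y = cong (S y ∨_) (forcers y)
    where
    forcers : ∀ y → anyF (λ b' → forces G S b' y) ≡ ⌊ y ≟ x ⌋
    forcers y with y ≟ x
    ... | yes refl = anyF-intro _ b (forces-complete G S b x fx)
    ... | no  y≢x  = anyF-false _ λ b' fy → y≢x (only b' y (forces-sound G S b' y fy))

  round-of-chain : ∀ {S S'} → Chain G S → ForceStep G S S' → ∀ y → round G S y ≡ S' y
  round-of-chain c (u , v , Su , Sv , auv , others , S'≡) y =
    trans (round-single fv (λ b' y fy → sym (forced-unique c fv fy)) y) (sym (S'≡ y))
    where
    fv : Forces G _ u v
    fv = (Su , Sv , auv , others)

  chain-round : ∀ {S} → Chain G S → (∀ x → S x ≡ round G S x) ⊎ ForceStep G S (round G S)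
  chain-round {S} c with all? (λ x → Bool._≟_ (S x) (round G S x))
  ... | yes stuck = inj₁ stuck
  ... | no  moves =
    let (x , Sx , roundSx) = round-new G S moves
        (b , bx)           = anyF-elim _ (∨-right Sx roundSx)
        fx                 = forces-sound G S b x bx
        (Sb , _ , abx , others) = fx
    in inj₂ (b , x , Sb , Sx , abx , others , round-single fx (λ b' y fy → forced-unique c fy fx))

  chain-cum : ∀ {B} → (c : Chain G B) → ∀ t →
    Σ (Chain G (cum G B t)) λ c' → Chain.k c' ≤ t + Chain.k c
  chain-cum c zero = c , ≤-refl
  chain-cum {B} c (suc t) with chain-cum c t
  ... | c' , k'≤ with chain-round c'
  ...   | inj₁ stuck = let (c'' , k''≡) = chain-cong stuck c' in
                       c'' , ≤-trans (≤-reflexive k''≡) (≤-trans k'≤ (n≤1+n _))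
  ...   | inj₂ force = let (c'' , k''≡) = chain-extend c' force in
                       c'' , ≤-trans (≤-reflexive k''≡) (s≤s k'≤)

chain-path : ∀ {n} (G : Graph (suc n)) {S} → Chain G S → Full S → IsPath G
chain-path {n} G {S} c full = mk↔ₛ′ to from to∘from from∘to , adjacency
  where
  open Chain c
  k≡n : k ≡ n
  k≡n = suc-injective (trans (sym size-S) (size-full S full))
  to : Fin (suc n) → Fin (suc n)
  to u = fromℕ< (s≤s (subst (lab u ≤_) k≡n (lab-≤ u (full u))))
  to-lab : ∀ u → toℕ (to u) ≡ lab u
  to-lab u = toℕ-fromℕ< _
  vertex : (i : Fin (suc n)) → Σ (Fin (suc n)) λ u → S u ≡ true × lab u ≡ toℕ i
  vertex i = lab-onto (toℕ i) (subst (toℕ i ≤_) (sym k≡n) (≤-pred (toℕ<n i)))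
  from : Fin (suc n) → Fin (suc n)
  from i = proj₁ (vertex i)
  to∘from : ∀ i → to (from i) ≡ i
  to∘from i = toℕ-injective (trans (to-lab (from i)) (proj₂ (proj₂ (vertex i))))
  from∘to : ∀ u → from (to u) ≡ u
  from∘to u = lab-inj _ u (full _) (full u) (trans (proj₂ (proj₂ (vertex (to u)))) (to-lab u))
  adjacency : ∀ u w → adj G u w ≡ pathAdj (to u) (to w)
  adjacency u w = trans (adj-lab u w (full u) (full w)) (sym (cong₂ consecutive (to-lab u) (to-lab w)))

module _ {n} (G : Graph (suc n)) where

  -- A one-vertex zero forcing set grows as a chain until it covers G, so G is a path.
  singleton-zfs-path : ∀ Z → ZeroForcingSet G Z → size Z ≡ 1 → IsPath G
  singleton-zfs-path Z (S , forcing , full) |Z|≡1 =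
    chain-path G (chain-along G forcing (chain-singleton G Z |Z|≡1)) full

  singleton-slow : ∀ B t → size B ≡ 1 → Full (cum G B t) → n ≤ t
  singleton-slow B t |B|≡1 full = begin
    n                ≡⟨ suc-injective (trans (sym (Chain.size-S c)) (size-full _ full)) ⟨
    Chain.k c        ≤⟨ k≤t+0 ⟩
    t + 0            ≡⟨ +-identityʳ t ⟩
    t                ∎
    where
    open ≤-Reasoning
    grown : Σ (Chain G (cum G B t)) λ c → Chain.k c ≤ t + 0
    grown = chain-cum G (chain-singleton G B |B|≡1) t
    c : Chain G (cum G B t)
    c = proj₁ grown
    k≤t+0 : Chain.k c ≤ t + 0
    k≤t+0 = proj₂ grown

  ptc-≤ : ∀ B t → ZeroForcingSet G B → IsPtcOf G B t → t ≤ n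
  ptc-≤ B t zfs ptc = ≤-pred (≤-trans (+-monoˡ-≤ t (zfs-nonempty G B zfs)) (ptc-bound G B t ptc))

  slow-singleton : ∀ B → ZeroForcingSet G B → IsPtcOf G B n → size B ≡ 1
  slow-singleton B zfs ptc =
    ≤-antisym (+-cancelʳ-≤ n (size B) 1 (ptc-bound G B n ptc)) (zfs-nonempty G B zfs)

-- On the path P_n, the endpoint at position 0 forces the vertices in order.
module PathEndpoint {n} (G : Graph (suc n)) (iso : IsPath G) where
  open Inverse (proj₁ iso) using (to; from; strictlyInverseˡ; strictlyInverseʳ)

  pos : Fin (suc n) → ℕ
  pos u = toℕ (to u)

  pos-adj : ∀ u w → adj G u w ≡ consecutive (pos u) (pos w)
  pos-adj = proj₂ iso

  pos-inj : ∀ u w → pos u ≡ pos w → u ≡ w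
  pos-inj u w e = trans (sym (strictlyInverseʳ u)) (trans (cong from (toℕ-injective e)) (strictlyInverseʳ w))

  at : ∀ i → i < suc n → Fin (suc n)
  at i i≤n = from (fromℕ< i≤n)

  pos-at : ∀ i i≤n → pos (at i i≤n) ≡ i
  pos-at i i≤n = trans (cong toℕ (strictlyInverseˡ (fromℕ< i≤n))) (toℕ-fromℕ< i≤n)

  initial : ℕ → VSet (suc n)
  initial t u = ⌊ pos u ≤? t ⌋

  endpoint : VSet (suc n)
  endpoint = initial 0

  end : Fin (suc n)
  end = at 0 (s≤s z≤n)

  endpoint-is-end : ∀ u → endpoint u ≡ ⌊ u ≟ end ⌋
  endpoint-is-end u with u ≟ end
  ... | yes refl  = ⌊⌋-true (pos end ≤? 0) (≤-reflexive (pos-at 0 (s≤s z≤n)))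
  ... | no  u≢end = ⌊⌋-false (pos u ≤? 0) λ u≤0 →
                      u≢end (pos-inj u end (trans (n≤0⇒n≡0 u≤0) (sym (pos-at 0 (s≤s z≤n)))))

  endpoint-size : size endpoint ≡ 1
  endpoint-size = size-singleton endpoint end endpoint-is-end

  advance : ∀ t → t < n → ForceStep G (initial t) (initial (suc t))
  advance t t<n = u , v , ⌊⌋-true (pos u ≤? t) (≤-reflexive pos-u) , ⌊⌋-false (pos v ≤? t) v-beyond ,
                  adj-uv , others , extended
    where
    u v : Fin (suc n)
    u = at t (≤-trans t<n (n≤1+n n))
    v = at (suc t) (s≤s t<n)
    pos-u : pos u ≡ t
    pos-u = pos-at t (≤-trans t<n (n≤1+n n))
    pos-v : pos v ≡ suc t
    pos-v = pos-at (suc t) (s≤s t<n)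
    v-beyond : ¬ (pos v ≤ t)
    v-beyond v≤t = n≮n t (subst (_≤ t) pos-v v≤t)
    adj-uv : adj G u v ≡ true
    adj-uv = trans (pos-adj u v) (trans (cong₂ consecutive pos-u pos-v) (consecutive-suc t))
    is-v : ∀ x → pos x ≡ suc t → x ≡ v
    is-v x e = pos-inj x v (trans e (sym pos-v))
    others : ∀ x → adj G u x ≡ true → x ≢ v → initial t x ≡ true
    others x aux x≢v with consecutive-elim (pos u) (pos x) (trans (sym (pos-adj u x)) aux)
    ... | inj₁ after  = ⊥-elim (x≢v (is-v x (trans (sym after) (cong suc pos-u))))
    ... | inj₂ before = ⌊⌋-true (pos x ≤? t) (≤-trans (n≤1+n (pos x)) (≤-reflexive (trans before pos-u)))
    extended : ∀ x → initial (suc t) x ≡ (initial t x ∨ ⌊ x ≟ v ⌋)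
    extended x with pos x ≤? t
    ... | yes x≤t = ⌊⌋-true (pos x ≤? suc t) (≤-trans x≤t (n≤1+n t))
    ... | no  x≰t with x ≟ v
    ...   | yes refl = ⌊⌋-true (pos v ≤? suc t) (≤-reflexive pos-v)
    ...   | no  x≢v  = ⌊⌋-false (pos x ≤? suc t) λ x≤t+1 →
                         [ x≰t ∘ ≤-pred , x≢v ∘ is-v x ] (m≤n⇒m<n∨m≡n x≤t+1)

  forcing : ∀ t → t ≤ n → Star (ForceStep G) endpoint (initial t)
  forcing zero    _   = ε
  forcing (suc t) t<n = forcing t (≤-trans (n≤1+n t) t<n) ◅◅ (advance t t<n ◅ ε)

  initial-n-full : Full (initial n)
  initial-n-full x = ⌊⌋-true (pos x ≤? n) (≤-pred (toℕ<n (to x)))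

  endpoint-czfs : ConnectedZFS G endpoint
  endpoint-czfs = (initial n , forcing n ≤-refl , initial-n-full) , connected
    where
    only-end : ∀ u → endpoint u ≡ true → u ≡ end
    only-end u eu = ⌊⌋-witness (u ≟ end) (trans (sym (endpoint-is-end u)) eu)
    connected : InducesConnectedOnComponents G endpoint
    connected u w eu ew _ =
      subst₂ (WalkIn G endpoint) (sym (only-end u eu)) (sym (only-end w ew))
             (here (trans (endpoint-is-end end) (⌊⌋-true (end ≟ end) refl)))

  -- Every connected zero forcing set has a vertex, so the endpoint is a minimum one.
  endpoint-min : MinConnectedZFS G endpoint
  endpoint-min = endpoint-czfs , λ T czfs → subst (_≤ size T) (sym endpoint-size) (zfs-nonempty G T (proj₁ czfs))

  minimum-singleton : ∀ B → MinConnectedZFS G B → size B ≡ 1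
  minimum-singleton B ((zfs , _) , minimal) =
    ≤-antisym (subst (size B ≤_) endpoint-size (minimal endpoint endpoint-czfs)) (zfs-nonempty G B zfs)

  cum-initial : ∀ t → t ≤ n → ∀ x → cum G endpoint t x ≡ initial t x
  cum-initial zero    _   x = refl
  cum-initial (suc t) t<n x =
    trans (round-cong G _ _ (cum-initial t t≤n) x) (round-of-chain G chain-t (advance t t<n) x)
    where
    t≤n : t ≤ n
    t≤n = ≤-trans (n≤1+n t) t<n
    chain-t : Chain G (initial t)
    chain-t = chain-along G (forcing t t≤n) (chain-singleton G endpoint endpoint-size)

  -- The endpoint needs exactly n rounds: it fills the path at time n, and no
  -- single vertex can do so earlier.
  endpoint-ptc : IsPtcOf G endpoint n
  endpoint-ptc = (λ x → trans (cum-initial n ≤-refl x) (initial-n-full x)) ,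
                 λ t' t'<n full → n≮n t' (≤-trans t'<n (singleton-slow G endpoint t' endpoint-size full))

mainTheorem6 : (n : ℕ) (G : Graph (suc n)) → Connected G →
    (IsZc G 1 ⇔ IsPath G) × (IsPtc G n ⇔ IsPath G) × (IsPTc G n ⇔ IsPath G)
mainTheorem6 n G _ = mk⇔ Zc-path path-Zc , mk⇔ ptc-path path-ptc , mk⇔ PTc-path path-PTc
  where
  -- (ii),(iii) ⇒ (iv): propagation time n needs a one-vertex zero forcing set
  slow-path : ∀ B → ZeroForcingSet G B → IsPtcOf G B n → IsPath G
  slow-path B zfs ptc = singleton-zfs-path G B zfs (slow-singleton G B zfs ptc)

  Zc-path : IsZc G 1 → IsPath G
  Zc-path ((Z , (zfs , _) , |Z|≡1) , _) = singleton-zfs-path G Z zfs |Z|≡1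

  ptc-path : IsPtc G n → IsPath G
  ptc-path ((B , ((zfs , _) , _) , ptc) , _) = slow-path B zfs ptc

  PTc-path : IsPTc G n → IsPath G
  PTc-path ((B , ((zfs , _) , _) , ptc) , _) = slow-path B zfs ptc

  -- (iv) ⇒ (i),(ii),(iii): the endpoint attains all three values
  path-Zc : IsPath G → IsZc G 1
  path-Zc iso = (endpoint , endpoint-czfs , endpoint-size) , λ S czfs → zfs-nonempty G S (proj₁ czfs)
    where open PathEndpoint G iso

  path-ptc : IsPath G → IsPtc G n
  path-ptc iso = (endpoint , endpoint-min , endpoint-ptc) ,
                 λ B t min (full , _) → singleton-slow G B t (minimum-singleton B min) full
    where open PathEndpoint G iso

  path-PTc : IsPath G → IsPTc G n
  path-PTc iso = (endpoint , endpoint-min , endpoint-ptc) ,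
                 λ B t ((zfs , _) , _) ptc → ptc-≤ G B t zfs ptc
    where open PathEndpoint G iso
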